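{- Let $k \geq 3$ be an integer, let $H$ be a $k$-regular class 1 graph with $n$ vertices, and let $\{H_0,\ldots,H_{k-1}\}$ be an equitable matching decomposition of $H$. Then for any nonnegative integer $x \leq \frac{n}{2}$ there is an $(x,w)$-semipartition of $H$ with respect to $\{H_0,\dots,H_{k-1}\}$, where $w = x+\lfloor\frac{x-1}{k-1}\rfloor$.
   Context: All graphs are finite and simple. A $k$-regular graph is class 1 if its edges can be properly coloured with $k$ colours. A matching decomposition of $H$ is a set of edge-disjoint matchings partitioning $E(H)$; it is equitable if any two of its matchings differ in size by at most one. Given $X_i\subseteq E(H_i)$ for $i\in\mathbb{Z}_c$ (here $c=k$), a vertex $v$ is $i$-covered for $\{X_0,\dots,X_{c-1}\}$ if $v$ is incident with an edge of $X_i$ and either $v$ is incident with an edge of $X_{i+1}$ or no edge of $H_{i+1}$ is incident with $v$ (indices mod $c$). An $(x,w)$-semipartition with respect to $\{H_0,\dots,H_{c-1}\}$ is a family $\{X_0,\dots,X_{c-1}\}$ with $X_i\subseteq E(H_i)$, $|X_i|=x$ for each $i$, and such that for every $i\in\mathbb{Z}_c$ at least $w$ vertices of $H$ are $i$-covered for $\{X_0,\dots,X_{c-1}\}$. -}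

module Defs where

open import Data.Nat using (ℕ; zero; suc; _+_; _*_; _∸_; _/_; _≤_; _<ᵇ_)
open import Data.Nat.DivMod using (_%_; m%n<n)
open import Data.Bool using (Bool; true; false; if_then_else_; _∧_)
open import Data.Fin using (Fin; toℕ; fromℕ<)
open import Data.List using (List; map; allFin)
open import Data.Nat.ListAction using (sum)
open import Data.Product using (Σ; _×_; ∃-syntax)
open import Data.Sum using (_⊎_)
open import Relation.Nullary using (¬_)
open import Relation.Binary.PropositionalEquality using (_≡_; _≢_)
open import Function.Definitions using (Injective)

-- Edge subsets / spanning
-- subgraphs (matchings, X_i, ...) are represented the same way.
record Graph (n : ℕ) : Set where
  field
    adj    : Fin n → Fin n → Bool
    sym    : ∀ u v → adj u v ≡ adj v u
    irrefl : ∀ u → adj u u ≡ false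
open Graph public

count : ∀ {n} → (Fin n → Bool) → ℕ
count {n} p = sum (map (λ u → if p u then 1 else 0) (allFin n))

degree : ∀ {n} → Graph n → Fin n → ℕ
degree G v = count (adj G v)

numEdges : ∀ {n} → Graph n → ℕ
numEdges {n} G = sum (map (λ u → count (λ v → (toℕ u <ᵇ toℕ v) ∧ adj G u v)) (allFin n))

_⊆ᴱ_ : ∀ {n} → Graph n → Graph n → Set
G ⊆ᴱ H = ∀ u v → adj G u v ≡ true → adj H u v ≡ true

Regular : ∀ {n} → ℕ → Graph n → Set
Regular {n} k H = ∀ (v : Fin n) → degree H v ≡ k

Class1 : ∀ {n} → ℕ → Graph n → Set
Class1 {n} k H =
  Σ (Fin n → Fin n → Fin k) λ c →
    (∀ u v → adj H u v ≡ true → c u v ≡ c v u) ×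
    (∀ u v w → adj H u v ≡ true → adj H u w ≡ true → v ≢ w → c u v ≢ c u w)

IsMatching : ∀ {n} → Graph n → Set
IsMatching {n} M = ∀ (v : Fin n) → degree M v ≤ 1

MatchingDecomposition : ∀ {n c} → Graph n → (Fin c → Graph n) → Set
MatchingDecomposition {n} {c} H Hs =
  (∀ i → IsMatching (Hs i)) ×
  (∀ i j u v → i ≢ j → adj (Hs i) u v ≡ true → adj (Hs j) u v ≡ false) ×
  (∀ i → Hs i ⊆ᴱ H) ×
  (∀ u v → adj H u v ≡ true → ∃[ i ] adj (Hs i) u v ≡ true)

Equitable : ∀ {n c} → (Fin c → Graph n) → Set
Equitable Hs = ∀ i j → numEdges (Hs i) ≤ numEdges (Hs j) + 1

EquitableMatchingDecomposition : ∀ {n c} → Graph n → (Fin c → Graph n) → Set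
EquitableMatchingDecomposition H Hs = MatchingDecomposition H Hs × Equitable Hs

next : ∀ {c} → Fin c → Fin c
next {suc m} i = fromℕ< (m%n<n (suc (toℕ i)) (suc m))

Incident : ∀ {n} → Fin n → Graph n → Set
Incident v X = ∃[ u ] adj X v u ≡ true

Covered : ∀ {n c} → (Fin c → Graph n) → (Fin c → Graph n) → Fin c → Fin n → Set
Covered Hs Xs i v =
  Incident v (Xs i) × (Incident v (Xs (next i)) ⊎ ¬ Incident v (Hs (next i)))

AtLeast : ∀ {n} → ℕ → (Fin n → Set) → Set
AtLeast {n} w P = Σ (Fin w → Fin n) λ f → Injective _≡_ _≡_ f × (∀ j → P (f j))

Semipartition : ∀ {n c} → (Fin c → Graph n) → ℕ → ℕ → Set
Semipartition {n} {c} Hs x w =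
  Σ (Fin c → Graph n) λ Xs →
    (∀ i → Xs i ⊆ᴱ Hs i) ×
    (∀ i → numEdges (Xs i) ≡ x) ×
    (∀ i → AtLeast w (Covered Hs Xs i))

-- w = x + ⌊(x-1)/(k-1)⌋ (only used for k ≥ 3, where k - 1 ≠ 0).
-- For x = 0 the real value ⌊-1/(k-1)⌋ = -1 gives w = -1; here x ∸ 1 = 0
-- gives w = 0; both make "at least w vertices" vacuous.
wBound : ℕ → ℕ → ℕ
wBound x zero = x
wBound x (suc k') = x + (x ∸ 1) / suc k'

module Submission where

-- Regularity forces every matching H_c of the decomposition to be perfect, i.e. an involution
-- mate c without fixed points.  We grow a vertex set T (the core) together with, for each colour c,
-- a set of c-edges covering T; every vertex of T is then i-covered for every i.  T grows along a walk
-- that cycles through the colours.  From the current vertex u, a step of colour c moves to mate c u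
-- if it is new: its c-edge is already chosen, so colour c pays nothing.  Otherwise it moves to an
-- arbitrary new vertex, and colour c can afford it because u itself was free in colour c when it was
-- added.  So in each round of k steps every colour saves an edge: after q = ⌊(x-1)/(k-1)⌋ rounds from
-- a single vertex, |T| = 1 + qk while every colour has at most |T| - q edges.  Padding T to x + q
-- vertices and completing each colour greedily to x edges (possible as 2x ≤ n) gives the result.

open import Defs hiding (sym)
import Algebra.Properties.CommutativeMonoid.Sum as Sum
open import Data.Bool using (Bool; true; false; not; _∧_; _∨_; if_then_else_)
open import Data.Bool.Properties using (∨-zeroʳ; ∧-zeroʳ; ∧-identityʳ; ∧-assoc)
open import Data.Fin using (Fin; zero; suc; toℕ; fromℕ<; punchIn)
open import Data.Fin.Permutation using (permutation)
open import Data.Fin.Properties using (_≟_; suc-injective; toℕ-injective; toℕ<n; toℕ-fromℕ<)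
open import Data.List using (map; allFin; tabulate)
open import Data.List.Properties using (map-tabulate)
open import Data.Nat using (ℕ; zero; suc; _+_; _*_; _∸_; _/_; _≤_; _<_; _<ᵇ_; z≤n; s≤s; s≤s⁻¹; z<s)
open import Data.Nat.DivMod using (m/n*n≤m; m/n≤m)
open import Data.Nat.ListAction using () renaming (sum to sumˡ)
open import Data.Nat.Properties hiding (_≟_; suc-injective)
open import Algebra.Properties.CommutativeSemigroup +-commutativeSemigroup using (x∙yz≈y∙xz)
open import Data.Product using (_×_; _,_; proj₁; proj₂; ∃-syntax)
open import Data.Sum using (_⊎_; inj₁; inj₂)
open import Function using (_∘_; id; case_of_)
open import Function.Definitions using (Injective)
open import Relation.Binary.Definitions using (tri<; tri≈; tri>)
open import Relation.Binary.PropositionalEquality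
open import Relation.Nullary using (does; yes; no; contradiction)
open import Relation.Nullary.Decidable using (dec-true; dec-false)

open Sum +-0-commutativeMonoid
  using (sum-syntax; sum-cong-≗; sum-replicate-zero; sum-remove; ∑-distrib-+; ∑-comm; ∑-permute)

indicator : Bool → ℕ
indicator b = if b then 1 else 0

∣_∣ : ∀ {n} → (Fin n → Bool) → ℕ
∣_∣ {n} p = ∑[ u < n ] indicator (p u)

insert : ∀ {n} → Fin n → (Fin n → Bool) → Fin n → Bool
insert v p u = does (u ≟ v) ∨ p u

sumˡ-allFin : ∀ {n} (f : Fin n → ℕ) → sumˡ (map f (allFin n)) ≡ ∑[ i < n ] f i
sumˡ-allFin {zero} f = refl
sumˡ-allFin {suc n} f = cong (f zero +_) (begin
  sumˡ (map f (tabulate suc))      ≡⟨ cong sumˡ (map-tabulate suc f) ⟩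
  sumˡ (tabulate (f ∘ suc))        ≡⟨ cong sumˡ (map-tabulate id (f ∘ suc)) ⟨
  sumˡ (map (f ∘ suc) (allFin n))  ≡⟨ sumˡ-allFin (f ∘ suc) ⟩
  ∑[ i < n ] f (suc i)             ∎)
  where open ≡-Reasoning

count≡∣∣ : ∀ {n} (p : Fin n → Bool) → count p ≡ ∣ p ∣
count≡∣∣ p = sumˡ-allFin (indicator ∘ p)

∑-mono : ∀ {n} {f g : Fin n → ℕ} → (∀ i → f i ≤ g i) → ∑[ i < n ] f i ≤ ∑[ i < n ] g i
∑-mono {zero}  f≤g = z≤n
∑-mono {suc n} f≤g = +-mono-≤ (f≤g zero) (∑-mono (f≤g ∘ suc))

term≤∑ : ∀ {n} (f : Fin n → ℕ) i → f i ≤ ∑[ j < n ] f j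
term≤∑ f zero    = m≤m+n (f zero) _
term≤∑ f (suc i) = ≤-trans (term≤∑ (f ∘ suc) i) (m≤n+m _ (f zero))

∑≤n : ∀ {n} (f : Fin n → ℕ) → (∀ i → f i ≤ 1) → ∑[ i < n ] f i ≤ n
∑≤n {zero}  f f≤1 = z≤n
∑≤n {suc n} f f≤1 = +-mono-≤ (f≤1 zero) (∑≤n (f ∘ suc) (f≤1 ∘ suc))

∣∅∣ : ∀ {n} → ∣ (λ (_ : Fin n) → false) ∣ ≡ 0
∣∅∣ {n} = sum-replicate-zero n

infix 4 _⊆_
_⊆_ : ∀ {n} → (Fin n → Bool) → (Fin n → Bool) → Set
p ⊆ q = ∀ u → p u ≡ true → q u ≡ true

∣∣-cong : ∀ {n} {p q : Fin n → Bool} → (∀ u → p u ≡ q u) → ∣ p ∣ ≡ ∣ q ∣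
∣∣-cong p≗q = sum-cong-≗ (cong indicator ∘ p≗q)

∣∣-mono : ∀ {n} {p q : Fin n → Bool} → p ⊆ q → ∣ p ∣ ≤ ∣ q ∣
∣∣-mono {p = p} p⊆q = ∑-mono λ u → indicator-mono (p u) (p⊆q u)
  where
  indicator-mono : ∀ {y} x → (x ≡ true → y ≡ true) → indicator x ≤ indicator y
  indicator-mono false _   = z≤n
  indicator-mono true  x⇒y rewrite x⇒y refl = ≤-refl

∣∪∣≤ : ∀ {n} (p q : Fin n → Bool) → ∣ (λ u → p u ∨ q u) ∣ ≤ ∣ p ∣ + ∣ q ∣
∣∪∣≤ {n} p q = ≤-trans (∑-mono λ u → indicator-∨ (p u) (q u))
                        (≤-reflexive (∑-distrib-+ (indicator ∘ p) (indicator ∘ q)))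
  where
  indicator-∨ : ∀ x y → indicator (x ∨ y) ≤ indicator x + indicator y
  indicator-∨ true  _ = s≤s z≤n
  indicator-∨ false _ = ≤-refl

∣∘involution∣ : ∀ {n} (p : Fin n → Bool) (f : Fin n → Fin n) → (∀ u → f (f u) ≡ u) → ∣ p ∘ f ∣ ≡ ∣ p ∣
∣∘involution∣ p f f∘f≡id = sym (∑-permute (indicator ∘ p) (permutation f f f∘f≡id f∘f≡id))

∣insert∣ : ∀ {n} v (p : Fin n → Bool) → ∣ insert v p ∣ ≡ indicator (not (p v)) + ∣ p ∣
∣insert∣ zero p with p zero
... | true  = refl
... | false = refl
∣insert∣ (suc v) p = begin
  indicator (p zero) + ∣ insert v (p ∘ suc) ∣                ≡⟨ cong (indicator (p zero) +_) (∣insert∣ v (p ∘ suc)) ⟩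
  indicator (p zero) + (indicator (not (p (suc v))) + ∣ p ∘ suc ∣) ≡⟨ x∙yz≈y∙xz (indicator (p zero)) (indicator (not (p (suc v)))) _ ⟩
  indicator (not (p (suc v))) + ∣ p ∣                        ∎
  where open ≡-Reasoning

∣∣<n⇒∃-false : ∀ {n} (p : Fin n → Bool) → ∣ p ∣ < n → ∃[ v ] p v ≡ false
∣∣<n⇒∃-false {suc n} p ∣p∣<n with p zero in eq
... | false = zero , eq
... | true  = let v , pv = ∣∣<n⇒∃-false (p ∘ suc) (s≤s⁻¹ ∣p∣<n) in suc v , pv

0<∣∣⇒∃-true : ∀ {n} (p : Fin n → Bool) → 0 < ∣ p ∣ → ∃[ v ] p v ≡ true
0<∣∣⇒∃-true {suc n} p 0<∣p∣ with p zero in eq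
... | true  = zero , eq
... | false = let v , pv = 0<∣∣⇒∃-true (p ∘ suc) 0<∣p∣ in suc v , pv

2≤∣∣ : ∀ {n} (p : Fin n → Bool) {a b} → a ≢ b → p a ≡ true → p b ≡ true → 2 ≤ ∣ p ∣
2≤∣∣ {n} p {a} {b} a≢b pa pb = subst (_≤ ∣ p ∣) ∣pair∣ (∣∣-mono pair⊆p)
  where
  pair = insert a (insert b (λ _ → false))
  ∣pair∣ : ∣ pair ∣ ≡ 2
  ∣pair∣ rewrite ∣insert∣ a (insert b (λ _ → false)) | ∣insert∣ b (λ (_ : Fin n) → false)
               | dec-false (a ≟ b) a≢b | ∣∅∣ {n} = refl
  pair⊆p : pair ⊆ p
  pair⊆p u _ with u ≟ a | u ≟ b
  pair⊆p u _  | yes refl | _        = pa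
  pair⊆p u _  | no _     | yes refl = pb

enumerate : ∀ {n} (p : Fin n → Bool) → AtLeast ∣ p ∣ (λ v → p v ≡ true)
enumerate {zero}  p = (λ ()) , (λ { {()} }) , λ ()
enumerate {suc n} p with p zero in eq | enumerate (p ∘ suc)
... | false | f , f-inj , f-in = suc ∘ f , (λ e → f-inj (suc-injective e)) , f-in
... | true  | f , f-inj , f-in = g , g-inj , g-in
  where
  g : Fin (suc ∣ p ∘ suc ∣) → Fin (suc n)
  g zero    = zero
  g (suc j) = suc (f j)
  g-inj : Injective _≡_ _≡_ g
  g-inj {zero}  {zero}  _ = refl
  g-inj {suc i} {suc j} e = cong suc (f-inj (suc-injective e))
  g-in : ∀ j → p (g j) ≡ true
  g-in zero    = eq
  g-in (suc j) = f-in j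

insert-∋ : ∀ {n} v (p : Fin n → Bool) → insert v p v ≡ true
insert-∋ v p = cong (_∨ p v) (dec-true (v ≟ v) refl)

insert-⊇ : ∀ {n} v (p : Fin n → Bool) {u} → p u ≡ true → insert v p u ≡ true
insert-⊇ v p {u} pu = trans (cong (does (u ≟ v) ∨_) pu) (∨-zeroʳ _)

insert-cases : ∀ {n} v (p : Fin n → Bool) {u} → insert v p u ≡ true → u ≡ v ⊎ p u ≡ true
insert-cases v p {u} h with u ≟ v
... | yes u≡v = inj₁ u≡v
... | no  _   = inj₂ h

∣insert∣≤ : ∀ {n} v (p : Fin n → Bool) → ∣ insert v p ∣ ≤ suc ∣ p ∣
∣insert∣≤ v p rewrite ∣insert∣ v p with p v
... | true  = n≤1+n _
... | false = ≤-refl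

∣insert-∈∣ : ∀ {n} v (p : Fin n → Bool) → p v ≡ true → ∣ insert v p ∣ ≡ ∣ p ∣
∣insert-∈∣ v p pv rewrite ∣insert∣ v p | pv = refl

∣insert-∉∣ : ∀ {n} v (p : Fin n → Bool) → p v ≡ false → ∣ insert v p ∣ ≡ suc ∣ p ∣
∣insert-∉∣ v p pv rewrite ∣insert∣ v p | pv = refl

∣∧≟∣ : ∀ {n} (q : Fin n → Bool) a → ∣ (λ v → q v ∧ does (v ≟ a)) ∣ ≡ indicator (q a)
∣∧≟∣ {suc n} q zero rewrite ∧-identityʳ (q zero) =
  trans (cong (indicator (q zero) +_) (trans (sum-cong-≗ λ v → cong indicator (∧-zeroʳ (q (suc v)))) (∣∅∣ {n})))
        (+-identityʳ _)
∣∧≟∣ q (suc a) rewrite ∧-zeroʳ (q zero) = ∣∧≟∣ (q ∘ suc) a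

degree≡∣∣ : ∀ {n} (G : Graph n) v → degree G v ≡ ∣ adj G v ∣
degree≡∣∣ G v = count≡∣∣ (adj G v)

matching-neighbour-unique : ∀ {n} (M : Graph n) → IsMatching M →
                            ∀ {v a b} → adj M v a ≡ true → adj M v b ≡ true → a ≡ b
matching-neighbour-unique M M-matching {v} {a} {b} va vb with a ≟ b
... | yes a≡b = a≡b
... | no  a≢b = contradiction (subst (_≤ 1) (degree≡∣∣ M v) (M-matching v)) (<⇒≱ (2≤∣∣ (adj M v) a≢b va vb))

module PerfectMatchings {n k} (H : Graph n) (Hs : Fin (suc k) → Graph n)
                        (H-regular : Regular (suc k) H) (decomposition : MatchingDecomposition H Hs) where

  private
    matchings : ∀ c → IsMatching (Hs c)
    matchings = proj₁ decomposition

    covering : ∀ u v → adj H u v ≡ true → ∃[ c ] adj (Hs c) u v ≡ true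
    covering = proj₂ (proj₂ (proj₂ decomposition))

  degree≤∑degree : ∀ v → degree H v ≤ ∑[ c < suc k ] degree (Hs c) v
  degree≤∑degree v = begin
    degree H v                                          ≡⟨ degree≡∣∣ H v ⟩
    ∑[ u < n ] indicator (adj H v u)                    ≤⟨ ∑-mono edge-in-some-colour ⟩
    ∑[ u < n ] ∑[ c < suc k ] indicator (adj (Hs c) v u) ≡⟨ ∑-comm (λ u c → indicator (adj (Hs c) v u)) ⟩
    ∑[ c < suc k ] ∣ adj (Hs c) v ∣                     ≡⟨ sum-cong-≗ (λ c → degree≡∣∣ (Hs c) v) ⟨
    ∑[ c < suc k ] degree (Hs c) v                      ∎
    where
    open ≤-Reasoning
    edge-in-some-colour : ∀ u → indicator (adj H v u) ≤ ∑[ c < suc k ] indicator (adj (Hs c) v u)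
    edge-in-some-colour u with adj H v u in vu
    ... | false = z≤n
    ... | true  = let c , c-vu = covering v u vu
                  in subst (_≤ _) (cong indicator c-vu) (term≤∑ (λ c → indicator (adj (Hs c) v u)) c)

  partner : ∀ c v → ∃[ u ] adj (Hs c) v u ≡ true
  partner c v = 0<∣∣⇒∃-true (adj (Hs c) v) (n≢0⇒n>0 degree≢0)
    where
    degree≢0 : ∣ adj (Hs c) v ∣ ≢ 0
    degree≢0 degree≡0 = 1+n≰n (begin
      suc k                                                  ≡⟨ H-regular v ⟨
      degree H v                                             ≤⟨ degree≤∑degree v ⟩
      ∑[ c′ < suc k ] degree (Hs c′) v                       ≡⟨ sum-remove {i = c} (λ c′ → degree (Hs c′) v) ⟩
      degree (Hs c) v + ∑[ j < k ] degree (Hs (punchIn c j)) v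
        ≡⟨ cong (_+ ∑[ j < k ] degree (Hs (punchIn c j)) v) (trans (degree≡∣∣ (Hs c) v) degree≡0) ⟩
      ∑[ j < k ] degree (Hs (punchIn c j)) v                 ≤⟨ ∑≤n _ (λ j → matchings (punchIn c j) v) ⟩
      k                                                      ∎)
      where open ≤-Reasoning

  -- Opaque: only mate-adj is used about the choice, and unfolding the search stalls unification.
  opaque
    mate : Fin (suc k) → Fin n → Fin n
    mate c v = proj₁ (partner c v)

    mate-adj : ∀ c v → adj (Hs c) v (mate c v) ≡ true
    mate-adj c v = proj₂ (partner c v)

  mate-unique : ∀ c {v u} → adj (Hs c) v u ≡ true → u ≡ mate c v
  mate-unique c {v} vu = matching-neighbour-unique (Hs c) (matchings c) vu (mate-adj c v)

  mate-involutive : ∀ c v → mate c (mate c v) ≡ v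
  mate-involutive c v = sym (mate-unique c (trans (Graph.sym (Hs c) (mate c v) v) (mate-adj c v)))

  mate-irreflexive : ∀ c v → mate c v ≢ v
  mate-irreflexive c v mate≡v
    with () ← trans (sym (mate-adj c v)) (trans (cong (adj (Hs c) v) mate≡v) (irrefl (Hs c) v))

module Construction {n m} (H : Graph n) (Hs : Fin (2 + m) → Graph n)
                    (H-regular : Regular (2 + m) H) (decomposition : MatchingDecomposition H Hs) where

  open PerfectMatchings H Hs H-regular decomposition

  Colour : Set
  Colour = Fin (2 + m)

  -- A chosen c-edge {v, mate c v} is recorded by low c v, its endpoint of smaller index.
  low : Colour → Fin n → Fin n
  low c v = if does (toℕ v <? toℕ (mate c v)) then v else mate c v

  low≡id : ∀ c v → toℕ v < toℕ (mate c v) → low c v ≡ v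
  low≡id c v v<mate rewrite dec-true (toℕ v <? toℕ (mate c v)) v<mate = refl

  low≡mate : ∀ c v → toℕ (mate c v) < toℕ v → low c v ≡ mate c v
  low≡mate c v mate<v rewrite dec-false (toℕ v <? toℕ (mate c v)) (<⇒≯ mate<v) = refl

  toℕ-mate≢ : ∀ c v → toℕ v ≢ toℕ (mate c v)
  toℕ-mate≢ c v eq = mate-irreflexive c v (toℕ-injective (sym eq))

  low-mate : ∀ c v → low c (mate c v) ≡ low c v
  low-mate c v with <-cmp (toℕ v) (toℕ (mate c v))
  ... | tri< v<mate _ _ = begin
    low c (mate c v)  ≡⟨ low≡mate c (mate c v) (subst (λ w → toℕ w < toℕ (mate c v)) (sym (mate-involutive c v)) v<mate) ⟩
    mate c (mate c v) ≡⟨ mate-involutive c v ⟩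
    v                 ≡⟨ low≡id c v v<mate ⟨
    low c v           ∎
    where open ≡-Reasoning
  ... | tri≈ _ v≡mate _ = contradiction v≡mate (toℕ-mate≢ c v)
  ... | tri> _ _ mate<v = begin
    low c (mate c v) ≡⟨ low≡id c (mate c v) (subst (λ w → toℕ (mate c v) < toℕ w) (sym (mate-involutive c v)) mate<v) ⟩
    mate c v         ≡⟨ low≡mate c v mate<v ⟨
    low c v          ∎
    where open ≡-Reasoning

  low-cases : ∀ c v → low c v ≡ v ⊎ low c v ≡ mate c v
  low-cases c v with <-cmp (toℕ v) (toℕ (mate c v))
  ... | tri< v<mate _ _ = inj₁ (low≡id c v v<mate)
  ... | tri≈ _ v≡mate _ = contradiction v≡mate (toℕ-mate≢ c v)
  ... | tri> _ _ mate<v = inj₂ (low≡mate c v mate<v)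

  low-idem : ∀ c v → low c (low c v) ≡ low c v
  low-idem c v with low-cases c v
  ... | inj₁ low≡v    = cong (low c) low≡v
  ... | inj₂ low≡mate = trans (cong (low c) low≡mate) (low-mate c v)

  low≡id⇒< : ∀ c {u} → low c u ≡ u → toℕ u < toℕ (mate c u)
  low≡id⇒< c {u} low≡u with <-cmp (toℕ u) (toℕ (mate c u))
  ... | tri< u<mate _ _ = u<mate
  ... | tri≈ _ u≡mate _ = contradiction u≡mate (toℕ-mate≢ c u)
  ... | tri> _ _ mate<u = contradiction (trans (sym (low≡mate c u mate<u)) low≡u) (mate-irreflexive c u)

  IsLowSet : Colour → (Fin n → Bool) → Set
  IsLowSet c P = ∀ u → P u ≡ true → low c u ≡ u

  insert-low : ∀ c v {P} → IsLowSet c P → IsLowSet c (insert (low c v) P)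
  insert-low c v {P} P-low u u∈ with insert-cases (low c v) P u∈
  ... | inj₁ refl = low-idem c v
  ... | inj₂ u∈P  = P-low u u∈P

  ∣P∘low∣≤ : ∀ c P → ∣ P ∘ low c ∣ ≤ ∣ P ∣ + ∣ P ∣
  ∣P∘low∣≤ c P = begin
    ∣ P ∘ low c ∣                  ≤⟨ ∣∣-mono low-endpoint ⟩
    ∣ (λ v → P v ∨ P (mate c v)) ∣ ≤⟨ ∣∪∣≤ P (P ∘ mate c) ⟩
    ∣ P ∣ + ∣ P ∘ mate c ∣         ≡⟨ cong (∣ P ∣ +_) (∣∘involution∣ P (mate c) (mate-involutive c)) ⟩
    ∣ P ∣ + ∣ P ∣                  ∎
    where
    open ≤-Reasoning
    low-endpoint : P ∘ low c ⊆ (λ v → P v ∨ P (mate c v))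
    low-endpoint v h with low-cases c v
    ... | inj₁ low≡v    = cong (_∨ P (mate c v)) (subst (λ w → P w ≡ true) low≡v h)
    ... | inj₂ low≡mate = trans (cong (P v ∨_) (subst (λ w → P w ≡ true) low≡mate h)) (∨-zeroʳ _)

  complete-by : ∀ c d {x P} → IsLowSet c P → ∣ P ∣ + d ≡ x → 2 * x ≤ n →
                ∃[ P′ ] IsLowSet c P′ × ∣ P′ ∣ ≡ x × P ⊆ P′
  complete-by c zero    {P = P} P-low ∣P∣≡x _ = P , P-low , trans (sym (+-identityʳ _)) ∣P∣≡x , λ _ h → h
  complete-by c (suc d) {x} {P} P-low ∣P∣+d≡x 2x≤n =
    let P′ , P′-low , ∣P′∣≡x , P+⊆P′ = complete-by c d (insert-low c v P-low) ∣P+∣+d≡x 2x≤n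
    in  P′ , P′-low , ∣P′∣≡x , λ u h → P+⊆P′ u (insert-⊇ (low c v) P h)
    where
    ∣P∣<x : ∣ P ∣ < x
    ∣P∣<x = subst (∣ P ∣ <_) ∣P∣+d≡x (m<m+n ∣ P ∣ z<s)
    uncovered : ∃[ v ] P (low c v) ≡ false
    uncovered = ∣∣<n⇒∃-false (P ∘ low c) (begin-strict
      ∣ P ∘ low c ∣ ≤⟨ ∣P∘low∣≤ c P ⟩
      ∣ P ∣ + ∣ P ∣ <⟨ +-mono-< ∣P∣<x ∣P∣<x ⟩
      x + x         ≡⟨ cong (x +_) (+-identityʳ x) ⟨
      2 * x         ≤⟨ 2x≤n ⟩
      n             ∎)
      where open ≤-Reasoning
    v = proj₁ uncovered
    ∣P+∣+d≡x : ∣ insert (low c v) P ∣ + d ≡ x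
    ∣P+∣+d≡x = trans (cong (_+ d) (∣insert-∉∣ (low c v) P (proj₂ uncovered))) (trans (sym (+-suc ∣ P ∣ d)) ∣P∣+d≡x)

  chosenEdges : Colour → (Fin n → Bool) → Graph n
  chosenEdges c P = record
    { adj    = λ u v → P (low c u) ∧ does (v ≟ mate c u)
    ; sym    = symmetric
    ; irrefl = λ u → trans (cong (P (low c u) ∧_) (dec-false (u ≟ mate c u) (mate-irreflexive c u ∘ sym))) (∧-zeroʳ _)
    }
    where
    symmetric : ∀ u v → P (low c u) ∧ does (v ≟ mate c u) ≡ P (low c v) ∧ does (u ≟ mate c v)
    symmetric u v with v ≟ mate c u
    ... | yes refl rewrite low-mate c u | dec-true (u ≟ mate c (mate c u)) (sym (mate-involutive c u)) = refl
    ... | no v≢mate rewrite dec-false (u ≟ mate c v) (λ u≡mate → v≢mate (trans (sym (mate-involutive c v)) (cong (mate c) (sym u≡mate))))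
      = trans (∧-zeroʳ _) (sym (∧-zeroʳ _))

  chosenEdges⊆ : ∀ c P → chosenEdges c P ⊆ᴱ Hs c
  chosenEdges⊆ c P u v uv with v ≟ mate c u
  ... | yes refl = mate-adj c u
  ... | no _ rewrite ∧-zeroʳ (P (low c u)) with () ← uv

  incident-chosenEdges : ∀ c P {v} → P (low c v) ≡ true → Incident v (chosenEdges c P)
  incident-chosenEdges c P {v} h = mate c v , cong₂ _∧_ h (dec-true (mate c v ≟ mate c v) refl)

  numEdges-chosenEdges : ∀ c {P} → IsLowSet c P → numEdges (chosenEdges c P) ≡ ∣ P ∣
  numEdges-chosenEdges c {P} P-low =
    trans (sumˡ-allFin (λ u → count (λ v → (toℕ u <ᵇ toℕ v) ∧ adj (chosenEdges c P) u v))) (sum-cong-≗ row)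
    where
    open ≡-Reasoning
    first-endpoint : ∀ u → does (toℕ u <? toℕ (mate c u)) ∧ P (low c u) ≡ P u
    first-endpoint u with <-cmp (toℕ u) (toℕ (mate c u))
    ... | tri< u<mate _ _ = cong₂ _∧_ (dec-true (toℕ u <? toℕ (mate c u)) u<mate) (cong P (low≡id c u u<mate))
    ... | tri≈ _ u≡mate _ = contradiction u≡mate (toℕ-mate≢ c u)
    ... | tri> _ _ mate<u with P u in Pu
    ...   | true  = contradiction (low≡id⇒< c (P-low u Pu)) (<⇒≯ mate<u)
    ...   | false = cong (_∧ P (low c u)) (dec-false (toℕ u <? toℕ (mate c u)) (<⇒≯ mate<u))
    row : ∀ u → count (λ v → (toℕ u <ᵇ toℕ v) ∧ (P (low c u) ∧ does (v ≟ mate c u))) ≡ indicator (P u)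
    row u = begin
      count (λ v → (toℕ u <ᵇ toℕ v) ∧ (P (low c u) ∧ does (v ≟ mate c u)))
        ≡⟨ count≡∣∣ (λ v → (toℕ u <ᵇ toℕ v) ∧ (P (low c u) ∧ does (v ≟ mate c u))) ⟩
      ∣ (λ v → (toℕ u <ᵇ toℕ v) ∧ (P (low c u) ∧ does (v ≟ mate c u))) ∣
        ≡⟨ ∣∣-cong (λ v → sym (∧-assoc (toℕ u <ᵇ toℕ v) (P (low c u)) (does (v ≟ mate c u)))) ⟩
      ∣ (λ v → ((toℕ u <ᵇ toℕ v) ∧ P (low c u)) ∧ does (v ≟ mate c u)) ∣
        ≡⟨ ∣∧≟∣ (λ v → (toℕ u <ᵇ toℕ v) ∧ P (low c u)) (mate c u) ⟩
      indicator ((toℕ u <ᵇ toℕ (mate c u)) ∧ P (low c u))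
        ≡⟨ cong indicator (first-endpoint u) ⟩
      indicator (P u)
        ∎

  record Partial : Set where
    field
      core         : Fin n → Bool
      picked       : Colour → Fin n → Bool
      picked-low   : ∀ c → IsLowSet c (picked c)
      core-covered : ∀ c → core ⊆ (picked c ∘ low c)
  open Partial public

  empty : Partial
  empty = record
    { core = λ _ → false ; picked = λ _ _ → false ; picked-low = λ _ _ () ; core-covered = λ _ _ () }

  extend : Partial → Fin n → Partial
  extend s v = record
    { core         = insert v (core s)
    ; picked       = λ c → insert (low c v) (picked s c)
    ; picked-low   = λ c → insert-low c v (picked-low s c)
    ; core-covered = covered
    }
    where
    covered : ∀ c → insert v (core s) ⊆ (insert (low c v) (picked s c) ∘ low c)
    covered c w w∈ with insert-cases v (core s) w∈
    ... | inj₁ refl   = insert-∋ (low c w) (picked s c)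
    ... | inj₂ w∈core = insert-⊇ (low c v) (picked s c) (core-covered s c w w∈core)

  ∣core-extend∣ : ∀ s {v} → core s v ≡ false → ∣ core (extend s v) ∣ ≡ suc ∣ core s ∣
  ∣core-extend∣ s {v} = ∣insert-∉∣ v (core s)

  ∣picked-extend∣≤ : ∀ s v c → ∣ picked (extend s v) c ∣ ≤ suc ∣ picked s c ∣
  ∣picked-extend∣≤ s v c = ∣insert∣≤ (low c v) (picked s c)

  ∣picked-extend∣-covered : ∀ s {v} c → picked s c (low c v) ≡ true → ∣ picked (extend s v) c ∣ ≡ ∣ picked s c ∣
  ∣picked-extend∣-covered s {v} c = ∣insert-∈∣ (low c v) (picked s c)

  Lags : (Colour → ℕ) → Partial → Set
  Lags b s = ∀ c → ∣ picked s c ∣ + b c ≤ ∣ core s ∣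

  extend-lags : ∀ {b s v} → core s v ≡ false → Lags b s → Lags b (extend s v)
  extend-lags {b} {s} {v} v∉ lags c = begin
    ∣ picked (extend s v) c ∣ + b c ≤⟨ +-monoˡ-≤ (b c) (∣picked-extend∣≤ s v c) ⟩
    suc (∣ picked s c ∣ + b c)      ≤⟨ s≤s (lags c) ⟩
    suc ∣ core s ∣                  ≡⟨ ∣core-extend∣ s v∉ ⟨
    ∣ core (extend s v) ∣           ∎
    where open ≤-Reasoning

  record Stage (s : Partial) (u : Fin n) (c : Colour) (b : Colour → ℕ) : Set where
    field
      visited : core s u ≡ true
      lags    : Lags b s
      -- Colour c has one edge to spare if the next step cannot use mate c u.
      spare   : core s (mate c u) ≡ true → ∣ picked s c ∣ + suc (b c) ≤ ∣ core s ∣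
  open Stage public

  arrive : ∀ {s b c d} v → core s v ≡ false → Lags b s → d ≢ c →
           ∀ b′ → (∀ c′ → c′ ≢ c → b′ c′ ≤ b c′) →
           ∣ picked (extend s v) c ∣ + b′ c ≤ ∣ core (extend s v) ∣ → Stage (extend s v) v d b′
  arrive {s} {b} {c} {d} v v∉ lag d≢c b′ b′≤b at-c = record
    { visited = insert-∋ v (core s) ; lags = lags′ ; spare = spare′ }
    where
    open ≤-Reasoning
    lags′ : Lags b′ (extend s v)
    lags′ c′ with c′ ≟ c
    ... | yes refl = at-c
    ... | no c′≢c  = ≤-trans (+-monoʳ-≤ ∣ picked (extend s v) c′ ∣ (b′≤b c′ c′≢c)) (extend-lags {b} {s} {v} v∉ lag c′)
    spare′ : core (extend s v) (mate d v) ≡ true → ∣ picked (extend s v) d ∣ + suc (b′ d) ≤ ∣ core (extend s v) ∣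
    spare′ mate∈ with insert-cases v (core s) mate∈
    ... | inj₁ mate≡v    = contradiction mate≡v (mate-irreflexive d v)
    ... | inj₂ mate∈core = begin
      ∣ picked (extend s v) d ∣ + suc (b′ d) ≡⟨ cong (_+ suc (b′ d)) (∣picked-extend∣-covered s d v-covered) ⟩
      ∣ picked s d ∣ + suc (b′ d)            ≤⟨ +-monoʳ-≤ _ (s≤s (b′≤b d d≢c)) ⟩
      ∣ picked s d ∣ + suc (b d)             ≡⟨ +-suc _ _ ⟩
      suc (∣ picked s d ∣ + b d)             ≤⟨ s≤s (lag d) ⟩
      suc ∣ core s ∣                         ≡⟨ ∣core-extend∣ s v∉ ⟨
      ∣ core (extend s v) ∣                  ∎
      where
      v-covered : picked s d (low d v) ≡ true
      v-covered = subst (λ w → picked s d w ≡ true) (low-mate d v) (core-covered s d (mate d v) mate∈core)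

  step : ∀ {s u c b} → Stage s u c b → ∣ core s ∣ < n → ∀ {d} → d ≢ c →
         ∀ b′ → (∀ c′ → c′ ≢ c → b′ c′ ≤ b c′) → b′ c ≤ suc (b c) →
         ∃[ s′ ] ∃[ u′ ] Stage s′ u′ d b′ × ∣ core s′ ∣ ≡ suc ∣ core s ∣
  step {s} {u} {c} {b} st ∣core∣<n d≢c b′ b′≤b b′c≤ with core s (mate c u) in mate∈?
  ... | false = extend s (mate c u) , mate c u , arrive (mate c u) mate∈? (lags st) d≢c b′ b′≤b free
              , ∣core-extend∣ s mate∈?
    where
    open ≤-Reasoning
    free : ∣ picked (extend s (mate c u)) c ∣ + b′ c ≤ ∣ core (extend s (mate c u)) ∣
    free = begin
      ∣ picked (extend s (mate c u)) c ∣ + b′ c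
        ≡⟨ cong (_+ b′ c) (∣picked-extend∣-covered s c (trans (cong (picked s c) (low-mate c u)) (core-covered s c u (visited st)))) ⟩
      ∣ picked s c ∣ + b′ c           ≤⟨ +-monoʳ-≤ _ b′c≤ ⟩
      ∣ picked s c ∣ + suc (b c)      ≡⟨ +-suc _ _ ⟩
      suc (∣ picked s c ∣ + b c)      ≤⟨ s≤s (lags st c) ⟩
      suc ∣ core s ∣                  ≡⟨ ∣core-extend∣ s mate∈? ⟨
      ∣ core (extend s (mate c u)) ∣  ∎
  ... | true = let v , v∉ = ∣∣<n⇒∃-false (core s) ∣core∣<n
               in extend s v , v , arrive v v∉ (lags st) d≢c b′ b′≤b (paid v v∉) , ∣core-extend∣ s v∉
    where
    open ≤-Reasoning
    paid : ∀ v → core s v ≡ false → ∣ picked (extend s v) c ∣ + b′ c ≤ ∣ core (extend s v) ∣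
    paid v v∉ = begin
      ∣ picked (extend s v) c ∣ + b′ c ≤⟨ +-mono-≤ (∣picked-extend∣≤ s v c) b′c≤ ⟩
      suc (∣ picked s c ∣ + suc (b c)) ≤⟨ s≤s (spare st mate∈?) ⟩
      suc ∣ core s ∣                   ≡⟨ ∣core-extend∣ s v∉ ⟨
      ∣ core (extend s v) ∣            ∎

  -- Lag bound after j steps of a round: colours 0 … j-1 have already saved their edge of this round.
  budget : ℕ → ℕ → Colour → ℕ
  budget r j c = if does (j ≤? toℕ c) then r else suc r

  budget-pending : ∀ r {j} c → j ≤ toℕ c → budget r j c ≡ r
  budget-pending r {j} c j≤c rewrite dec-true (j ≤? toℕ c) j≤c = refl

  budget-done : ∀ r {j} c → toℕ c < j → budget r j c ≡ suc r
  budget-done r {j} c c<j rewrite dec-false (j ≤? toℕ c) (<⇒≱ c<j) = refl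

  budget-≥ : ∀ r j c → r ≤ budget r j c
  budget-≥ r j c with j ≤? toℕ c
  ... | yes j≤c = ≤-reflexive (sym (budget-pending r c j≤c))
  ... | no  j≰c = ≤-trans (n≤1+n r) (≤-reflexive (sym (budget-done r c (≰⇒> j≰c))))

  budget-≤ : ∀ r j c → budget r j c ≤ suc r
  budget-≤ r j c with j ≤? toℕ c
  ... | yes j≤c = ≤-trans (≤-reflexive (budget-pending r c j≤c)) (n≤1+n r)
  ... | no  j≰c = ≤-reflexive (budget-done r c (≰⇒> j≰c))

  budget-suc : ∀ r {j} c → toℕ c ≢ j → budget r (suc j) c ≤ budget r j c
  budget-suc r {j} c c≢j with suc j ≤? toℕ c
  ... | yes j<c = ≤-trans (≤-reflexive (budget-pending r c j<c)) (budget-≥ r j c)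
  ... | no  j≮c = ≤-trans (budget-≤ r (suc j) c)
                          (≤-reflexive (sym (budget-done r c (≤∧≢⇒< (s≤s⁻¹ (≰⇒> j≮c)) c≢j))))

  toℕ≢ : ∀ {j} (j<K : j < 2 + m) {c} → c ≢ fromℕ< j<K → toℕ c ≢ j
  toℕ≢ j<K c≢j eq = c≢j (toℕ-injective (trans eq (sym (toℕ-fromℕ< j<K))))

  round-from : ∀ {r} rem j (j<K : j < 2 + m) → j + rem ≡ suc m →
               ∀ {s u} → Stage s u (fromℕ< j<K) (budget r j) → ∣ core s ∣ + suc rem ≤ n →
               ∃[ s′ ] ∃[ u′ ] Stage s′ u′ zero (λ _ → suc r) × ∣ core s′ ∣ ≡ ∣ core s ∣ + suc rem
  round-from {r} zero j j<K j+0≡ {s} st room =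
    let s′ , u′ , st′ , size = step st ∣core∣<n zero≢ (λ _ → suc r) all-done (s≤s (budget-≥ r j _))
    in  s′ , u′ , st′ , trans size (+-comm 1 _)
    where
    j≡ : j ≡ suc m
    j≡ = trans (sym (+-identityʳ j)) j+0≡
    ∣core∣<n : ∣ core s ∣ < n
    ∣core∣<n = <-≤-trans (m<m+n _ z<s) room
    zero≢ : zero ≢ fromℕ< j<K
    zero≢ eq with () ← trans (cong toℕ eq) (trans (toℕ-fromℕ< j<K) j≡)
    all-done : ∀ c → c ≢ fromℕ< j<K → suc r ≤ budget r j c
    all-done c c≢ = ≤-reflexive (sym (budget-done r c
      (≤∧≢⇒< (subst (toℕ c ≤_) (sym j≡) (s≤s⁻¹ (toℕ<n c))) (toℕ≢ j<K c≢))))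
  round-from {r} (suc rem) j j<K j+rem≡ {s} st room =
    let s′ , u′ , st′ , size′ = step st ∣core∣<n next≢ (budget r (suc j))
                                     (λ c c≢ → budget-suc r c (toℕ≢ j<K c≢))
                                     (≤-trans (budget-≤ r (suc j) (fromℕ< j<K)) (s≤s (budget-≥ r j (fromℕ< j<K))))
        s″ , u″ , st″ , size″ = round-from rem (suc j) j+1<K j+1+rem≡ st′ (subst (_≤ n) (sym (shift size′)) room)
    in  s″ , u″ , st″ , trans size″ (shift size′)
    where
    j+1+rem≡ : suc j + rem ≡ suc m
    j+1+rem≡ = trans (sym (+-suc j rem)) j+rem≡
    j+1<K : suc j < 2 + m
    j+1<K = s≤s (subst (suc j ≤_) j+1+rem≡ (m≤m+n (suc j) rem))
    ∣core∣<n : ∣ core s ∣ < n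
    ∣core∣<n = <-≤-trans (m<m+n _ z<s) room
    next≢ : fromℕ< j+1<K ≢ fromℕ< j<K
    next≢ eq = 1+n≢n (trans (sym (toℕ-fromℕ< j+1<K)) (trans (cong toℕ eq) (toℕ-fromℕ< j<K)))
    shift : ∀ {a} → a ≡ suc ∣ core s ∣ → a + suc rem ≡ ∣ core s ∣ + suc (suc rem)
    shift refl = sym (+-suc _ _)

  round : ∀ {r s u} → Stage s u zero (λ _ → r) → ∣ core s ∣ + (2 + m) ≤ n →
          ∃[ s′ ] ∃[ u′ ] Stage s′ u′ zero (λ _ → suc r) × ∣ core s′ ∣ ≡ ∣ core s ∣ + (2 + m)
  round = round-from (suc m) 0 z<s refl

  rounds : ∀ q {s u} → Stage s u zero (λ _ → 0) → ∣ core s ∣ + q * (2 + m) ≤ n →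
           ∃[ s′ ] ∃[ u′ ] Stage s′ u′ zero (λ _ → q) × ∣ core s′ ∣ ≡ ∣ core s ∣ + q * (2 + m)
  rounds zero    st _ = _ , _ , st , sym (+-identityʳ _)
  rounds (suc q) {s} st room =
    let s′ , u′ , st′ , size′ = rounds q st (≤-trans (+-monoʳ-≤ _ (m≤n+m (q * (2 + m)) (2 + m))) room)
        s″ , u″ , st″ , size″ = round st′ (subst (_≤ n) (sym (regroup size′)) room)
    in  s″ , u″ , st″ , trans size″ (regroup size′)
    where
    regroup : ∀ {a} → a ≡ ∣ core s ∣ + q * (2 + m) → a + (2 + m) ≡ ∣ core s ∣ + suc q * (2 + m)
    regroup refl = trans (+-assoc ∣ core s ∣ _ _) (cong (∣ core s ∣ +_) (+-comm (q * (2 + m)) (2 + m)))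

  pad : ∀ p {b s} → Lags b s → ∣ core s ∣ + p ≤ n → ∃[ s′ ] Lags b s′ × ∣ core s′ ∣ ≡ ∣ core s ∣ + p
  pad zero    {s = s} lag _ = s , lag , sym (+-identityʳ _)
  pad (suc p) {b} {s} lag room =
    let v , v∉ = ∣∣<n⇒∃-false (core s) (<-≤-trans (m<m+n ∣ core s ∣ z<s) room)
        s′ , lag′ , size′ = pad p {b} {extend s v} (extend-lags {b} {s} v∉ lag) (subst (_≤ n) (sym (shift v∉)) room)
    in  s′ , lag′ , trans size′ (shift v∉)
    where
    shift : ∀ {v} → core s v ≡ false → ∣ core (extend s v) ∣ + p ≡ ∣ core s ∣ + suc p
    shift v∉ = trans (cong (_+ p) (∣core-extend∣ s v∉)) (sym (+-suc _ p))

  start : ∀ u → Stage (extend empty u) u zero (λ _ → 0)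
  start u = record
    { visited = insert-∋ u _
    ; lags    = extend-lags {s = empty} {v = u} refl (λ _ → ≤-reflexive (+-identityʳ _))
    ; spare   = λ mate∈ → case insert-cases u _ mate∈ of λ where
                  (inj₁ mate≡u) → contradiction mate≡u (mate-irreflexive zero u)
                  (inj₂ ())
    }

  ∣core-start∣ : ∀ u → ∣ core (extend empty u) ∣ ≡ 1
  ∣core-start∣ u = trans (∣core-extend∣ empty refl) (cong suc (∣∅∣ {n}))

  semipartition : ∀ {x q} (s : Partial) → Lags (λ _ → q) s → ∣ core s ∣ ≤ x + q → x + q ≤ n → 2 * x ≤ n →
                  Semipartition Hs x (x + q)
  semipartition {x} {q} s₀ lag₀ ∣core₀∣≤ room 2x≤n = Xs , (λ c → chosenEdges⊆ c (P c)) , sizes , covered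
    where
    padded = pad (x + q ∸ ∣ core s₀ ∣) {s = s₀} lag₀ (subst (_≤ n) (sym (m+[n∸m]≡n ∣core₀∣≤)) room)
    s : Partial
    s = proj₁ padded
    ∣core∣≡ : ∣ core s ∣ ≡ x + q
    ∣core∣≡ = trans (proj₂ (proj₂ padded)) (m+[n∸m]≡n ∣core₀∣≤)
    ∣picked∣≤x : ∀ c → ∣ picked s c ∣ ≤ x
    ∣picked∣≤x c = +-cancelʳ-≤ q ∣ picked s c ∣ x (subst (∣ picked s c ∣ + q ≤_) ∣core∣≡ (proj₁ (proj₂ padded) c))
    completed : ∀ c → ∃[ P′ ] IsLowSet c P′ × ∣ P′ ∣ ≡ x × picked s c ⊆ P′
    completed c = complete-by c (x ∸ ∣ picked s c ∣) (picked-low s c) (m+[n∸m]≡n (∣picked∣≤x c)) 2x≤n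
    P : Colour → Fin n → Bool
    P c = proj₁ (completed c)
    Xs : Colour → Graph n
    Xs c = chosenEdges c (P c)
    sizes : ∀ c → numEdges (Xs c) ≡ x
    sizes c = let _ , P-low , ∣P∣≡x , _ = completed c in trans (numEdges-chosenEdges c P-low) ∣P∣≡x
    core-incident : ∀ c {v} → core s v ≡ true → Incident v (Xs c)
    core-incident c {v} v∈ =
      incident-chosenEdges c (P c) (proj₂ (proj₂ (proj₂ (completed c))) (low c v) (core-covered s c v v∈))
    covered : ∀ c → AtLeast (x + q) (Covered Hs Xs c)
    covered c = let f , f-inj , f-core = enumerate (core s)
                in  subst (λ w → AtLeast w (Covered Hs Xs c)) ∣core∣≡
                      (f , f-inj , λ j → core-incident c (f-core j) , inj₁ (core-incident (next c) (f-core j)))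

rounds-fit : ∀ k x′ → 1 + (x′ / suc k) * suc (suc k) ≤ suc x′ + x′ / suc k
rounds-fit k x′ = s≤s (begin
  q * suc (suc k) ≡⟨ *-suc q (suc k) ⟩
  q + q * suc k   ≤⟨ +-monoʳ-≤ q (m/n*n≤m x′ (suc k)) ⟩
  q + x′          ≡⟨ +-comm q x′ ⟩
  x′ + q          ∎)
  where
  open ≤-Reasoning
  q = x′ / suc k

target≤n : ∀ k x′ {n} → 2 * suc x′ ≤ n → suc x′ + x′ / suc k ≤ n
target≤n k x′ 2x≤n = ≤-trans (+-monoʳ-≤ (suc x′) q≤x) 2x≤n
  where
  q≤x : x′ / suc k ≤ suc x′ + 0
  q≤x = ≤-trans (m/n≤m x′ (suc k)) (≤-trans (n≤1+n x′) (≤-reflexive (sym (+-identityʳ _))))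

lemma6p2 : (k : ℕ) → 3 ≤ k → (n : ℕ) → (H : Graph n) →
    Regular k H → Class1 k H →
    (Hs : Fin k → Graph n) → EquitableMatchingDecomposition H Hs →
    (x : ℕ) → 2 * x ≤ n →
    Semipartition Hs x (wBound x (k ∸ 1))
lemma6p2 (suc (suc (suc k))) (s≤s (s≤s (s≤s _))) n H H-regular _ Hs (decomposition , _) = semipartition-of-size
  where
  open Construction H Hs H-regular decomposition
  semipartition-of-size : ∀ x → 2 * x ≤ n → Semipartition Hs x (wBound x (2 + k))
  semipartition-of-size zero 0≤n =
    semipartition empty (λ _ → ≤-reflexive (+-identityʳ _)) (≤-reflexive (∣∅∣ {n})) z≤n 0≤n
  semipartition-of-size (suc x′) 2x≤n =
    let s , _ , st , ∣s∣ = rounds q (start u₀) room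
    in  semipartition s (lags st) (subst (_≤ suc x′ + q) (sym (trans ∣s∣ (cong (_+ q * (3 + k)) (∣core-start∣ u₀)))) fits)
          x+q≤n 2x≤n
    where
    q = x′ / suc (suc k)
    fits = rounds-fit (suc k) x′
    x+q≤n = target≤n (suc k) x′ 2x≤n
    u₀ : Fin n
    u₀ = fromℕ< (≤-trans (s≤s z≤n) 2x≤n)
    room : ∣ core (extend empty u₀) ∣ + q * (3 + k) ≤ n
    room = subst (λ a → a + q * (3 + k) ≤ n) (sym (∣core-start∣ u₀)) (≤-trans fits x+q≤n)
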